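{- Let $K\geq 3$, $n\geq1$, $m\geq 1$ be integers. Let $G$ be uniformly distributed on $\Xi_{m,n}$, and let $\breve G$ be its 2-core, with $\breve m$ edges and $\breve n_j$ vertices in the $j$th part ($j=1,\ldots,K$), $\breve{\mathbf n}=(\breve n_1,\ldots,\breve n_K)$. Then, conditioned on the size $(\breve m,\breve{\mathbf n})$, $\breve G$ is equally likely to be any 2-core $K$-XORGAME hypergraph of that size; i.e. (identifying the vertices of the $j$th part of $\breve G$ with $\{1,\ldots,\breve n_j\}$ in an order-preserving way) $\breve G$ is uniformly distributed on $\Psi_{\breve m,\breve{\mathbf n}}$.
   Context: A $K$-XORGAME hypergraph is a $K$-uniform $K$-partite hypergraph: its vertex set is partitioned into parts $V_1,\ldots,V_K$ and each edge contains exactly one vertex from each part. $\Xi_{m,n}$ is the set of $K$-XORGAME hypergraphs with parts $V_1,\ldots,V_K$ of size $n$ each (so $Kn$ vertices) and $m$ edges. The 2-core of a hypergraph $G$ is its largest induced sub-hypergraph of minimum degree at least 2, where an edge of $G$ belongs to the induced sub-hypergraph on a vertex set $W$ exactly when all its vertices lie in $W$. $\Psi_{\breve m,\breve{\mathbf n}}$ is the set of $K$-XORGAME hypergraphs with parts of sizes $\breve n_1,\ldots,\breve n_K$, $\breve m$ edges, and every vertex of degree at least 2 (equivalently, $\breve m\times(\breve n_1+\cdots+\breve n_K)$ binary matrices whose $K$ blocks each have exactly one $1$ per row and at least two $1$'s per column, rows corresponding to edges). -}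

module Defs where

open import Data.Nat using (ℕ)
open import Data.Fin using (Fin; _<_)
open import Data.Fin.Subset using (Subset; _∈_; _⊆_)
open import Data.Vec using (Vec; lookup)
open import Data.Product using (Σ; ∃; _×_)
open import Relation.Binary.PropositionalEquality using (_≡_; _≢_)

-- Ξ_{m,n}: a K-XORGAME hypergraph with parts of size n and m edges,
-- given as its list of m (labelled, ordered) edges; edge i picks the
-- vertex (lookup (lookup G i) j) in part j.  (Matrix reading: row i.)
Ξ : (K m n : ℕ) → Set
Ξ K m n = Vec (Vec (Fin n) K) m

vertexOf : ∀ {K m n} → Ξ K m n → Fin m → Fin K → Fin n
vertexOf G i j = lookup (lookup G i) j

VSet : (K n : ℕ) → Set
VSet K n = Fin K → Subset n

InducedEdge : ∀ {K m n} → Ξ K m n → VSet K n → Fin m → Set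
InducedEdge G W i = ∀ j → vertexOf G i j ∈ W j

MinDeg2 : ∀ {K m n} → Ξ K m n → VSet K n → Set
MinDeg2 G W = ∀ j v → v ∈ W j →
  Σ _ λ i → Σ _ λ i' → i ≢ i' × InducedEdge G W i × InducedEdge G W i'
    × vertexOf G i j ≡ v × vertexOf G i' j ≡ v

IsTwoCore : ∀ {K m n} → Ξ K m n → VSet K n → Set
IsTwoCore G W = MinDeg2 G W × (∀ W' → MinDeg2 G W' → ∀ j → W' j ⊆ W j)

StrictlyIncreasing : ∀ {a b} → (Fin a → Fin b) → Set
StrictlyIncreasing f = ∀ x y → x < y → f x < f y

Hyp : (K m̆ : ℕ) → (Fin K → ℕ) → Set
Hyp K m̆ n̆ = Fin m̆ → (j : Fin K) → Fin (n̆ j)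

-- Membership in Ψ_{m̆,n̆}: every vertex has degree ≥ 2.
AllDeg2 : ∀ {K m̆ n̆} → Hyp K m̆ n̆ → Set
AllDeg2 H = ∀ j v → Σ _ λ i → Σ _ λ i' → i ≢ i' × H i j ≡ v × H i' j ≡ v

-- The 2-core of G, with edges and the vertices of each part relabelled
-- order-preservingly by 1..m̆ and 1..n̆ j, is exactly H.
CoreIs : ∀ {K m n m̆ n̆} → Ξ K m n → Hyp K m̆ n̆ → Set
CoreIs {K} {m} {n} {m̆} {n̆} G H =
  Σ (VSet K n) λ W → IsTwoCore G W ×
  Σ (Fin m̆ → Fin m) λ f → StrictlyIncreasing f ×
    (∀ i → (InducedEdge G W i → ∃ λ k → f k ≡ i) × (∀ k → f k ≡ i → InducedEdge G W i)) ×
  Σ ((j : Fin K) → Fin (n̆ j) → Fin n) λ g → (∀ j → StrictlyIncreasing (g j)) ×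
    (∀ j v → (v ∈ W j → ∃ λ u → g j u ≡ v) × (∀ u → g j u ≡ v → v ∈ W j)) ×
    (∀ k j → vertexOf G (f k) j ≡ g j (H k j))

{-# OPTIONS --safe #-}
-- Let W be the vertex set of the 2-core of G, f the increasing enumeration of the edges
-- induced by W and g that of W.  Overwriting the edges f k by the edges of another 2-core
-- hypergraph H′ of the same size (relabelled through g) only changes edges lying inside W.
-- Every edge with a vertex outside W is untouched, so the union of W with any vertex set of
-- minimum degree 2 in the new graph has minimum degree 2 in the old one; hence W is still the
-- 2-core, now carrying H′, with the same f and g.  Since the core data (W, f, g, H) is unique,
-- overwriting back recovers G.  This gives a bijection between the graphs with core H₁ and
-- those with core H₂, extended by the identity to an involution of Ξ; all case distinctions
-- are decidable because every object involved is finite.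
module Submission where

open import Defs
open import Data.Nat using (ℕ; zero; suc; _≤_)
open import Data.Nat.Base using (z<s; s<s)
import Data.Nat.Properties as ℕ
open import Data.Fin using (Fin; zero; suc; _<_)
import Data.Fin as Fin
open import Data.Fin.Properties using (any?; all?; _≟_; _<?_; <-cmp; <⇒≢; ∀-cons)
import Data.Fin.Properties as Finₚ
open import Data.Fin.Subset using (Subset; _∈_; _∉_; _⊆_; _∪_)
open import Data.Fin.Subset.Properties using (_∈?_; _⊆?_; anySubset?; x∈p∪q⁺; x∈p∪q⁻)
open import Data.Vec using (tabulate; lookup)
open import Data.Vec.Properties using (lookup∘tabulate; tabulate∘lookup; tabulate-cong)
open import Data.Product using (Σ; ∃; _×_; _,_; proj₁; proj₂)
open import Data.Sum using (_⊎_; inj₁; inj₂)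
open import Function using (_∘_; id)
open import Function.Definitions using (Injective)
open import Level using (0ℓ)
open import Relation.Binary.Core using (Rel)
open import Relation.Binary.Definitions using (Reflexive; Symmetric; _Respects_; tri<; tri≈; tri>)
open import Relation.Binary.PropositionalEquality
  using (_≡_; _≢_; _≗_; refl; sym; trans; cong; subst; subst₂; module ≡-Reasoning)
open import Relation.Nullary using (Dec; yes; no; ¬_; contradiction)
open import Relation.Nullary.Decidable using (_×-dec_; _→-dec_; ¬?; map′; decidable-stable)
open import Relation.Unary using (Pred; Decidable)

-- Without function extensionality a search through a function space only sees its elements up to
-- pointwise equality, hence the relation.
Searchable : (A : Set) → Rel A 0ℓ → Set₁
Searchable A _≈_ = ∀ {P : Pred A 0ℓ} → P Respects _≈_ → Decidable P → Dec (∃ P)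

search-Fin : ∀ {n} → Searchable (Fin n) _≡_
search-Fin _ = any?

search-Subset : ∀ {n} → Searchable (Subset n) _≡_
search-Subset _ = anySubset?

related-∀-cons : ∀ {k} {B : Fin (suc k) → Set} {R : ∀ j → Rel (B j) 0ℓ}
  {h : (j : Fin (suc k)) → B j} {x : B zero} {t : (j : Fin k) → B (suc j)} →
  R zero (h zero) x → (∀ j → R (suc j) (h (suc j)) (t j)) →
  ∀ j → R j (h j) (∀-cons {P = B} x t j)
related-∀-cons r rs zero    = r
related-∀-cons r rs (suc j) = rs j

search-Π : ∀ {k} {B : Fin k → Set} {R : ∀ j → Rel (B j) 0ℓ} →
  (∀ j → Reflexive (R j)) → (∀ j → Searchable (B j) (R j)) →
  Searchable ((j : Fin k) → B j) (λ h h′ → ∀ j → R j (h j) (h′ j))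
search-Π {zero} refl′ search {P} resp P? =
  map′ (λ p → _ , p) (λ (h , p) → resp (λ ()) p) (P? λ ())
search-Π {suc k} {B} {R} refl′ search {P} resp P? =
  map′ (λ (x , t , p) → _ , p)
       (λ (h , p) → h zero , h ∘ suc ,
                    resp (related-∀-cons {R = R} (refl′ zero) (λ j → refl′ (suc j))) p)
       (search zero resp-head λ x →
          search-Π (refl′ ∘ suc) (search ∘ suc) (resp-tail x) (P? ∘ ∀-cons x))
  where
  resp-head : (λ x → ∃ λ t → P (∀-cons x t)) Respects R zero
  resp-head {x} x≈y (t , p) =
    t , resp (related-∀-cons {R = R} {h = ∀-cons x t} x≈y (λ j → refl′ (suc j))) p
  resp-tail : ∀ x → (P ∘ ∀-cons x) Respects (λ t t′ → ∀ j → R (suc j) (t j) (t′ j))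
  resp-tail x {t} t≈t′ = resp (related-∀-cons {R = R} {h = ∀-cons x t} (refl′ zero) t≈t′)

search-∀ : ∀ {A _≈_} → Searchable A _≈_ → Symmetric _≈_ →
  ∀ {P : Pred A 0ℓ} → P Respects _≈_ → Decidable P → Dec (∀ x → P x)
search-∀ search sym′ resp P?
  with search (λ x≈y ¬Px Py → ¬Px (resp (sym′ x≈y) Py)) (¬? ∘ P?)
... | yes (x , ¬Px) = no λ ∀P → ¬Px (∀P x)
... | no ∄¬P        = yes λ x → decidable-stable (P? x) λ ¬Px → ∄¬P (x , ¬Px)

module Swap {A : Set} {P Q : Pred A 0ℓ} (P? : Decidable P) (Q? : Decidable Q)
  (disjoint : ∀ {x} → P x → ¬ Q x)
  (to : ∀ {x} → P x → A) (from : ∀ {x} → Q x → A)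
  (to-Q : ∀ {x} (p : P x) → Q (to p)) (from-P : ∀ {x} (q : Q x) → P (from q))
  (from-to : ∀ {x} (p : P x) (q : Q (to p)) → from q ≡ x)
  (to-from : ∀ {x} (q : Q x) (p : P (from q)) → to p ≡ x)
  where

  swap : A → A
  swap x with P? x | Q? x
  ... | yes p | _     = to p
  ... | no _  | yes q = from q
  ... | no _  | no _  = x

  private
    swap-outside : ∀ {x} → ¬ P x → ¬ Q x → swap x ≡ x
    swap-outside {x} ¬p ¬q with P? x | Q? x
    ... | yes p | _     = contradiction p ¬p
    ... | no _  | yes q = contradiction q ¬q
    ... | no _  | no _  = refl

    swap-on-P : ∀ {x y} → P x → (∀ p → to p ≡ y) → swap x ≡ y
    swap-on-P {x} p to≡y with P? x
    ... | yes p′ = to≡y p′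
    ... | no ¬p  = contradiction p ¬p

    swap-on-Q : ∀ {x y} → Q x → (∀ q → from q ≡ y) → swap x ≡ y
    swap-on-Q {x} q from≡y with P? x | Q? x
    ... | yes p | _      = contradiction q (disjoint p)
    ... | no _  | yes q′ = from≡y q′
    ... | no _  | no ¬q  = contradiction q ¬q

  swap-involutive : ∀ x → swap (swap x) ≡ x
  swap-involutive x with P? x | Q? x
  ... | yes p | _     = swap-on-Q (to-Q p) (from-to p)
  ... | no _  | yes q = swap-on-P (from-P q) (to-from q)
  ... | no ¬p | no ¬q = swap-outside ¬p ¬q

  swap-P⇒Q : ∀ {x} → P x → Q (swap x)
  swap-P⇒Q {x} p with P? x
  ... | yes p′ = to-Q p′
  ... | no ¬p  = contradiction p ¬p

  swap-Q⇒P : ∀ {x} → Q (swap x) → P x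
  swap-Q⇒P {x} q with P? x | Q? x
  ... | yes p | _      = p
  ... | no _  | yes q′ = contradiction q (disjoint (from-P q′))
  ... | no _  | no ¬q  = contradiction q ¬q

module _ {a b : ℕ} where

  strictlyIncreasing⇒injective : {h : Fin a → Fin b} →
    StrictlyIncreasing h → Injective _≡_ _≡_ h
  strictlyIncreasing⇒injective {h} si {x} {y} hx≡hy with <-cmp x y
  ... | tri< x<y _ _ = contradiction hx≡hy (<⇒≢ (si x y x<y))
  ... | tri≈ _ x≡y _ = x≡y
  ... | tri> _ _ y<x = contradiction (sym hx≡hy) (<⇒≢ (si y x y<x))

  strictlyIncreasing-cong : {h h′ : Fin a → Fin b} →
    h ≗ h′ → StrictlyIncreasing h → StrictlyIncreasing h′
  strictlyIncreasing-cong h≗h′ si x y x<y = subst₂ _<_ (h≗h′ x) (h≗h′ y) (si x y x<y)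

  strictlyIncreasing? : (h : Fin a → Fin b) → Dec (StrictlyIncreasing h)
  strictlyIncreasing? h = all? λ x → all? λ y → x <? y →-dec h x <? h y

  Enumerates : (Fin a → Fin b) → Pred (Fin b) 0ℓ → Set
  Enumerates h P = ∀ y → (P y → ∃ λ x → h x ≡ y) × (∀ x → h x ≡ y → P y)

  enumerates-cong : {h h′ : Fin a → Fin b} {P : Pred (Fin b) 0ℓ} →
    h ≗ h′ → Enumerates h P → Enumerates h′ P
  enumerates-cong h≗h′ enum y =
    (λ Py → let (x , hx≡y) = proj₁ (enum y) Py in x , trans (sym (h≗h′ x)) hx≡y) ,
    (λ x h′x≡y → proj₂ (enum y) x (trans (h≗h′ x) h′x≡y))

  enumerates-⇔ : {h : Fin a → Fin b} {P Q : Pred (Fin b) 0ℓ} →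
    (∀ {y} → P y → Q y) → (∀ {y} → Q y → P y) → Enumerates h P → Enumerates h Q
  enumerates-⇔ P⇒Q Q⇒P enum y =
    proj₁ (enum y) ∘ Q⇒P , λ x hx≡y → P⇒Q (proj₂ (enum y) x hx≡y)

  enumerates⇒∈ : {h : Fin a → Fin b} {P : Pred (Fin b) 0ℓ} →
    Enumerates h P → ∀ x → P (h x)
  enumerates⇒∈ enum x = proj₂ (enum _) x refl

  enumerates? : (h : Fin a → Fin b) {P : Pred (Fin b) 0ℓ} → Decidable P → Dec (Enumerates h P)
  enumerates? h P? =
    all? λ y → (P? y →-dec any? λ x → h x ≟ y) ×-dec all? λ x → h x ≟ y →-dec P? y

strictlyIncreasing-zero-≤ : ∀ {a b} {h : Fin (suc a) → Fin b} →
  StrictlyIncreasing h → ∀ x → h zero Fin.≤ h x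
strictlyIncreasing-zero-≤ si zero    = Finₚ.≤-refl
strictlyIncreasing-zero-≤ si (suc x) = ℕ.<⇒≤ (si zero (suc x) z<s)

-- The minimum of the image of h is in the image of h′, which forces h′ zero ≤ h zero and
-- keeps the images of the tails h ∘ suc, h′ ∘ suc nested.
strictlyIncreasing-image-⊆⇒≥ : ∀ {a b} {h h′ : Fin a → Fin b} →
  StrictlyIncreasing h → StrictlyIncreasing h′ → (∀ x → ∃ λ y → h′ y ≡ h x) →
  ∀ x → h′ x Fin.≤ h x
strictlyIncreasing-image-⊆⇒≥ {h = h} {h′} si si′ im zero =
  subst (h′ zero Fin.≤_) (proj₂ (im zero)) (strictlyIncreasing-zero-≤ si′ (proj₁ (im zero)))
strictlyIncreasing-image-⊆⇒≥ {h = h} {h′} si si′ im (suc x) =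
  strictlyIncreasing-image-⊆⇒≥
    (λ x y → si (suc x) (suc y) ∘ s<s) (λ x y → si′ (suc x) (suc y) ∘ s<s) tail-im x
  where
  tail-im : ∀ x → ∃ λ y → h′ (suc y) ≡ h (suc x)
  tail-im x with im (suc x)
  ... | suc y , e = y , e
  ... | zero  , e = contradiction (si zero (suc x) z<s)
    (ℕ.≤⇒≯ (subst (Fin._≤ h zero) e (strictlyIncreasing-image-⊆⇒≥ si si′ im zero)))

strictlyIncreasing-unique : ∀ {a b} {h h′ : Fin a → Fin b} {P : Pred (Fin b) 0ℓ} →
  StrictlyIncreasing h → StrictlyIncreasing h′ → Enumerates h P → Enumerates h′ P → h ≗ h′
strictlyIncreasing-unique {h = h} {h′} si si′ enum enum′ x =
  Finₚ.≤-antisym (strictlyIncreasing-image-⊆⇒≥ si′ si h′⊆h x)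
                 (strictlyIncreasing-image-⊆⇒≥ si si′ h⊆h′ x)
  where
  h⊆h′ : ∀ x → ∃ λ y → h′ y ≡ h x
  h⊆h′ x = proj₁ (enum′ (h x)) (enumerates⇒∈ enum x)
  h′⊆h : ∀ x → ∃ λ y → h y ≡ h′ x
  h′⊆h x = proj₁ (enum (h′ x)) (enumerates⇒∈ enum′ x)

module _ {K n : ℕ} where

  private variable
    W W′ : VSet K n

  _⊆ᵥ_ : VSet K n → VSet K n → Set
  W ⊆ᵥ W′ = ∀ j → W j ⊆ W′ j

  _∪ᵥ_ : VSet K n → VSet K n → VSet K n
  (W ∪ᵥ W′) j = W j ∪ W′ j

  W⊆W∪W′ : W ⊆ᵥ (W ∪ᵥ W′)
  W⊆W∪W′ j = x∈p∪q⁺ ∘ inj₁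

  W′⊆W∪W′ : W′ ⊆ᵥ (W ∪ᵥ W′)
  W′⊆W∪W′ j = x∈p∪q⁺ ∘ inj₂

  _≐_ : VSet K n → VSet K n → Set
  W ≐ W′ = ∀ j → W j ≡ W′ j

  ≐⇒⊆ᵥ : W ≐ W′ → W ⊆ᵥ W′
  ≐⇒⊆ᵥ W≐W′ j {v} = subst (v ∈_) (W≐W′ j)

  search-VSet : Searchable (VSet K n) _≐_
  search-VSet = search-Π (λ _ → refl) (λ _ → search-Subset)

module _ {K m n : ℕ} where

  private variable
    G G′ : Ξ K m n
    W W′ U : VSet K n
    i : Fin m
    j : Fin K
    v : Fin n

  fromEntries : (Fin m → Fin K → Fin n) → Ξ K m n
  fromEntries e = tabulate (tabulate ∘ e)

  vertexOf-fromEntries : ∀ e i j → vertexOf (fromEntries e) i j ≡ e i j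
  vertexOf-fromEntries e i j =
    trans (cong (λ row → lookup row j) (lookup∘tabulate (tabulate ∘ e) i))
          (lookup∘tabulate (e i) j)

  Ξ-ext : (∀ i j → vertexOf G i j ≡ vertexOf G′ i j) → G ≡ G′
  Ξ-ext {G} {G′} G≗G′ = begin
    G                                           ≡⟨ tabulate∘lookup G ⟨
    tabulate (lookup G)                         ≡⟨ tabulate-cong row≡ ⟩
    tabulate (lookup G′)                        ≡⟨ tabulate∘lookup G′ ⟩
    G′                                          ∎
    where
    open ≡-Reasoning
    row≡ : lookup G ≗ lookup G′
    row≡ i = begin
      lookup G i                      ≡⟨ tabulate∘lookup (lookup G i) ⟨
      tabulate (vertexOf G i)         ≡⟨ tabulate-cong (G≗G′ i) ⟩
      tabulate (vertexOf G′ i)        ≡⟨ tabulate∘lookup (lookup G′ i) ⟩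
      lookup G′ i                     ∎

  TwoEdgesAt : Ξ K m n → VSet K n → Fin K → Fin n → Set
  TwoEdgesAt G W j v = Σ (Fin m) λ i → Σ (Fin m) λ i′ →
    i ≢ i′ × InducedEdge G W i × InducedEdge G W i′ × vertexOf G i j ≡ v × vertexOf G i′ j ≡ v

  twoEdgesAt-map :
    (∀ {i} → InducedEdge G W i → InducedEdge G′ W′ i) →
    (∀ {i} → vertexOf G i j ≡ v → vertexOf G′ i j ≡ v) →
    TwoEdgesAt G W j v → TwoEdgesAt G′ W′ j v
  twoEdgesAt-map ie⇒ e⇒ (i , i′ , i≢i′ , ie , ie′ , e , e′) =
    i , i′ , i≢i′ , ie⇒ ie , ie⇒ ie′ , e⇒ e , e⇒ e′

  inducedEdge-mono : W ⊆ᵥ W′ → InducedEdge G W i → InducedEdge G W′ i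
  inducedEdge-mono W⊆W′ ie j = W⊆W′ j (ie j)

  minDeg2-cong : W ⊆ᵥ W′ → W′ ⊆ᵥ W → MinDeg2 G W → MinDeg2 G W′
  minDeg2-cong {G = G} W⊆W′ W′⊆W md j v v∈W′ =
    twoEdgesAt-map {G = G} {G′ = G} (inducedEdge-mono {G = G} W⊆W′) id (md j v (W′⊆W j v∈W′))

  isTwoCore-cong : W ⊆ᵥ W′ → W′ ⊆ᵥ W → IsTwoCore G W → IsTwoCore G W′
  isTwoCore-cong {G = G} W⊆W′ W′⊆W (md , maximal) =
    minDeg2-cong {G = G} W⊆W′ W′⊆W md , λ U mdU j → W⊆W′ j ∘ maximal U mdU j

  inducedEdge? : (G : Ξ K m n) (W : VSet K n) → Decidable (InducedEdge G W)
  inducedEdge? G W i = all? λ j → vertexOf G i j ∈? W j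

  minDeg2? : (G : Ξ K m n) (W : VSet K n) → Dec (MinDeg2 G W)
  minDeg2? G W = all? λ j → all? λ v → v ∈? W j →-dec any? λ i → any? λ i′ →
    ¬? (i ≟ i′) ×-dec inducedEdge? G W i ×-dec inducedEdge? G W i′ ×-dec
    vertexOf G i j ≟ v ×-dec vertexOf G i′ j ≟ v

  isTwoCore? : (G : Ξ K m n) (W : VSet K n) → Dec (IsTwoCore G W)
  isTwoCore? G W = minDeg2? G W ×-dec
    search-∀ search-VSet (λ U≐U′ j → sym (U≐U′ j)) resp
      (λ U → minDeg2? G U →-dec all? λ j → U j ⊆? W j)
    where
    resp : (λ U → MinDeg2 G U → U ⊆ᵥ W) Respects _≐_
    resp U≐U′ maximal mdU′ j =
      maximal (minDeg2-cong {G = G} (≐⇒⊆ᵥ (sym ∘ U≐U′)) (≐⇒⊆ᵥ U≐U′) mdU′) j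
      ∘ ≐⇒⊆ᵥ (sym ∘ U≐U′) j

  record DifferOnlyInside (G G′ : Ξ K m n) (W : VSet K n) : Set where
    field
      edge : ∀ i → (InducedEdge G W i × InducedEdge G′ W i)
                 ⊎ (∀ j → vertexOf G i j ≡ vertexOf G′ i j)

  module _ {G G′ : Ξ K m n} {W : VSet K n} (d : DifferOnlyInside G G′ W) where
    open DifferOnlyInside d

    inducedEdge-transfer : W ⊆ᵥ U → InducedEdge G U i → InducedEdge G′ U i
    inducedEdge-transfer {U = U} {i = i} W⊆U ie with edge i
    ... | inj₁ (_ , ie′) = inducedEdge-mono {G = G′} W⊆U ie′
    ... | inj₂ same      = λ j → subst (_∈ U j) (same j) (ie j)

    inducedEdge-transfer⁻ : W ⊆ᵥ U → InducedEdge G′ U i → InducedEdge G U i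
    inducedEdge-transfer⁻ {U = U} {i = i} W⊆U ie′ with edge i
    ... | inj₁ (ie , _) = inducedEdge-mono {G = G} W⊆U ie
    ... | inj₂ same     = λ j → subst (_∈ U j) (sym (same j)) (ie′ j)

    vertex-transfer⁻ : v ∉ W j → vertexOf G′ i j ≡ v → vertexOf G i j ≡ v
    vertex-transfer⁻ {j = j} {i = i} v∉W e with edge i
    ... | inj₁ (_ , ie′) = contradiction (subst (_∈ W j) e (ie′ j)) v∉W
    ... | inj₂ same      = trans (same j) e

    minDeg2-∪ : MinDeg2 G W → MinDeg2 G′ W′ → MinDeg2 G (W ∪ᵥ W′)
    minDeg2-∪ {W′ = W′} md md′ j v v∈W∪W′ with v ∈? W j
    ... | yes v∈W =
      twoEdgesAt-map {G = G} {G′ = G} (inducedEdge-mono {G = G} W⊆W∪W′) id (md j v v∈W)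
    ... | no v∉W with x∈p∪q⁻ (W j) (W′ j) v∈W∪W′
    ...   | inj₁ v∈W  = contradiction v∈W v∉W
    ...   | inj₂ v∈W′ = twoEdgesAt-map {G = G′} {G′ = G}
        (inducedEdge-transfer⁻ W⊆W∪W′ ∘ inducedEdge-mono {G = G′} W′⊆W∪W′)
        (vertex-transfer⁻ v∉W) (md′ j v v∈W′)

    isTwoCore-transfer : IsTwoCore G W → MinDeg2 G′ W → IsTwoCore G′ W
    isTwoCore-transfer (md , maximal) md′ =
      md′ , λ W′ mdW′ j v∈W′ →
        maximal (W ∪ᵥ W′) (minDeg2-∪ md mdW′) j (W′⊆W∪W′ {W′ = W′} {W = W} j v∈W′)

module _ {K m n m̆ : ℕ} {n̆ : Fin K → ℕ} where

  private variable
    G : Ξ K m n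
    W W′ : VSet K n
    H H′ : Hyp K m̆ n̆

  VertexEmbedding : Set
  VertexEmbedding = (j : Fin K) → Fin (n̆ j) → Fin n

  _≗²_ : VertexEmbedding → VertexEmbedding → Set
  g ≗² g′ = ∀ j → g j ≗ g′ j

  search-VertexEmbedding : Searchable VertexEmbedding _≗²_
  search-VertexEmbedding =
    search-Π (λ _ _ → refl) (λ _ → search-Π (λ _ → refl) (λ _ → search-Fin))

  VertexLabelling : Ξ K m n → VSet K n → Hyp K m̆ n̆ → (Fin m̆ → Fin m) → VertexEmbedding → Set
  VertexLabelling G W H f g =
    (∀ j → StrictlyIncreasing (g j)) × (∀ j → Enumerates (g j) (_∈ W j)) ×
    (∀ k j → vertexOf G (f k) j ≡ g j (H k j))

  EdgeLabelling : Ξ K m n → VSet K n → Hyp K m̆ n̆ → (Fin m̆ → Fin m) → Set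
  EdgeLabelling G W H f =
    StrictlyIncreasing f × Enumerates f (InducedEdge G W) ×
    Σ VertexEmbedding (VertexLabelling G W H f)

  -- CoreIs G H unfolds to Σ W (IsTwoCore G W × InducedIs G W H).
  InducedIs : Ξ K m n → VSet K n → Hyp K m̆ n̆ → Set
  InducedIs G W H = Σ (Fin m̆ → Fin m) (EdgeLabelling G W H)

  inducedIs? : (G : Ξ K m n) (W : VSet K n) (H : Hyp K m̆ n̆) → Dec (InducedIs G W H)
  inducedIs? G W H = search-Π (λ _ → refl) (λ _ → search-Fin) edge-resp λ f →
    strictlyIncreasing? f ×-dec enumerates? f (inducedEdge? G W) ×-dec
    search-VertexEmbedding (vertex-resp f) λ g →
      (all? λ j → strictlyIncreasing? (g j)) ×-dec
      (all? λ j → enumerates? (g j) (_∈? W j)) ×-dec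
      (all? λ k → all? λ j → vertexOf G (f k) j ≟ g j (H k j))
    where
    vertex-resp : ∀ f → VertexLabelling G W H f Respects _≗²_
    vertex-resp f g≗g′ (si , enum , eqs) =
      (λ j → strictlyIncreasing-cong (g≗g′ j) (si j)) ,
      (λ j → enumerates-cong (g≗g′ j) (enum j)) ,
      λ k j → trans (eqs k j) (g≗g′ j (H k j))
    edge-resp : EdgeLabelling G W H Respects _≗_
    edge-resp f≗f′ (si , enum , g , si-g , enum-g , eqs) =
      strictlyIncreasing-cong f≗f′ si , enumerates-cong f≗f′ enum , g , si-g , enum-g ,
      λ k j → trans (cong (λ i → vertexOf G i j) (sym (f≗f′ k))) (eqs k j)

  inducedIs-cong : W ⊆ᵥ W′ → W′ ⊆ᵥ W → InducedIs G W H → InducedIs G W′ H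
  inducedIs-cong {G = G} W⊆W′ W′⊆W (f , si , enum , g , si-g , enum-g , eqs) =
    f , si ,
    enumerates-⇔ (inducedEdge-mono {G = G} W⊆W′) (inducedEdge-mono {G = G} W′⊆W) enum ,
    g , si-g , (λ j → enumerates-⇔ (W⊆W′ j) (W′⊆W j) (enum-g j)) , eqs

  coreIs? : (G : Ξ K m n) (H : Hyp K m̆ n̆) → Dec (CoreIs G H)
  coreIs? G H = search-VSet resp λ W → isTwoCore? G W ×-dec inducedIs? G W H
    where
    resp : (λ W → IsTwoCore G W × InducedIs G W H) Respects _≐_
    resp W≐W′ (tc , ind) =
      isTwoCore-cong {G = G} (≐⇒⊆ᵥ W≐W′) (≐⇒⊆ᵥ (sym ∘ W≐W′)) tc ,
      inducedIs-cong {G = G} (≐⇒⊆ᵥ W≐W′) (≐⇒⊆ᵥ (sym ∘ W≐W′)) ind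

  coreIs-cong : (∀ k j → H k j ≡ H′ k j) → CoreIs G H → CoreIs G H′
  coreIs-cong H≗H′ (W , tc , f , si , enum , g , si-g , enum-g , eqs) =
    W , tc , f , si , enum , g , si-g , enum-g , λ k j → trans (eqs k j) (cong (g j) (H≗H′ k j))

  coreEdges : CoreIs G H → Fin m̆ → Fin m
  coreEdges (_ , _ , f , _) = f

  coreVertices : CoreIs G H → VertexEmbedding
  coreVertices (_ , _ , _ , _ , _ , g , _) = g

  coreIs-unique : (c : CoreIs G H) (c′ : CoreIs G H′) →
    coreEdges {G = G} c ≗ coreEdges {G = G} c′ ×
    coreVertices {G = G} c ≗² coreVertices {G = G} c′ ×
    (∀ k j → H k j ≡ H′ k j)
  coreIs-unique {G = G} {H = H} {H′ = H′}
    (W  , (md  , maximal)  , f  , si  , enum  , g  , si-g  , enum-g  , eqs)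
    (W′ , (md′ , maximal′) , f′ , si′ , enum′ , g′ , si-g′ , enum-g′ , eqs′) =
    f≗f′ , g≗g′ , H≗H′
    where
    W⊆W′ : W ⊆ᵥ W′
    W⊆W′ = maximal′ W md
    W′⊆W : W′ ⊆ᵥ W
    W′⊆W = maximal W′ md′
    f≗f′ : f ≗ f′
    f≗f′ = strictlyIncreasing-unique si si′ enum
      (enumerates-⇔ (inducedEdge-mono {G = G} W′⊆W) (inducedEdge-mono {G = G} W⊆W′) enum′)
    g≗g′ : g ≗² g′
    g≗g′ j = strictlyIncreasing-unique (si-g j) (si-g′ j) (enum-g j)
      (enumerates-⇔ (W′⊆W j) (W⊆W′ j) (enum-g′ j))
    H≗H′ : ∀ k j → H k j ≡ H′ k j
    H≗H′ k j = strictlyIncreasing⇒injective (si-g j) (begin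
      g j (H k j)           ≡⟨ eqs k j ⟨
      vertexOf G (f k) j    ≡⟨ cong (λ i → vertexOf G i j) (f≗f′ k) ⟩
      vertexOf G (f′ k) j   ≡⟨ eqs′ k j ⟩
      g′ j (H′ k j)         ≡⟨ g≗g′ j (H′ k j) ⟨
      g j (H′ k j)          ∎)
      where open ≡-Reasoning

  replacedRow : (G : Ξ K m n) (f : Fin m̆ → Fin m) → VertexEmbedding → Hyp K m̆ n̆ →
    (i : Fin m) → Dec (∃ λ k → f k ≡ i) → Fin K → Fin n
  replacedRow G f g H i (yes (k , _)) j = g j (H k j)
  replacedRow G f g H i (no _)        j = vertexOf G i j

  replace : Ξ K m n → (Fin m̆ → Fin m) → VertexEmbedding → Hyp K m̆ n̆ → Ξ K m n
  replace G f g H = fromEntries λ i → replacedRow G f g H i (any? λ k → f k ≟ i)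

  module _ (G : Ξ K m n) (f : Fin m̆ → Fin m) (g : VertexEmbedding) (H : Hyp K m̆ n̆) where

    replace-hit : Injective _≡_ _≡_ f →
      ∀ k j → vertexOf (replace G f g H) (f k) j ≡ g j (H k j)
    replace-hit f-inj k j =
      trans (vertexOf-fromEntries _ (f k) j) (hit (any? λ k′ → f k′ ≟ f k))
      where
      hit : (d : Dec (∃ λ k′ → f k′ ≡ f k)) → replacedRow G f g H (f k) d j ≡ g j (H k j)
      hit (yes (k′ , fk′≡fk)) = cong (λ k → g j (H k j)) (f-inj fk′≡fk)
      hit (no ∄)              = contradiction (k , refl) ∄

    replace-miss : ∀ {i} → (∀ k → f k ≢ i) →
      ∀ j → vertexOf (replace G f g H) i j ≡ vertexOf G i j
    replace-miss {i} i∉f j = trans (vertexOf-fromEntries _ i j) (miss (any? λ k → f k ≟ i))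
      where
      miss : (d : Dec (∃ λ k → f k ≡ i)) → replacedRow G f g H i d j ≡ vertexOf G i j
      miss (yes (k , fk≡i)) = contradiction fk≡i (i∉f k)
      miss (no _)           = refl

    replace-induced : Injective _≡_ _≡_ f → (∀ j u → g j u ∈ W j) →
      ∀ k → InducedEdge (replace G f g H) W (f k)
    replace-induced {W = W} f-inj g∈W k j =
      subst (_∈ W j) (sym (replace-hit f-inj k j)) (g∈W j (H k j))

    replace-differOnlyInside : Injective _≡_ _≡_ f →
      (∀ k → InducedEdge G W (f k)) → (∀ j u → g j u ∈ W j) →
      DifferOnlyInside G (replace G f g H) W
    replace-differOnlyInside {W = W} f-inj f-induced g∈W = record { edge = edge }
      where
      edge : ∀ i → (InducedEdge G W i × InducedEdge (replace G f g H) W i)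
                 ⊎ (∀ j → vertexOf G i j ≡ vertexOf (replace G f g H) i j)
      edge i with any? (λ k → f k ≟ i)
      ... | yes (k , refl) = inj₁ (f-induced k , replace-induced f-inj g∈W k)
      ... | no i∉f         = inj₂ λ j → sym (replace-miss (λ k fk≡i → i∉f (k , fk≡i)) j)

    replace-minDeg2 : Injective _≡_ _≡_ f →
      (∀ j → Enumerates (g j) (_∈ W j)) → AllDeg2 H → MinDeg2 (replace G f g H) W
    replace-minDeg2 {W = W} f-inj enum-g deg j v v∈W with proj₁ (enum-g j v) v∈W
    ... | u , refl with deg j u
    ... | k , k′ , k≢k′ , Hk≡u , Hk′≡u =
      f k , f k′ , k≢k′ ∘ f-inj , induced k , induced k′ ,
      trans (replace-hit f-inj k j) (cong (g j) Hk≡u) ,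
      trans (replace-hit f-inj k′ j) (cong (g j) Hk′≡u)
      where
      induced : ∀ k → InducedEdge (replace G f g H) W (f k)
      induced = replace-induced f-inj λ j → enumerates⇒∈ (enum-g j)

  replaceCore : (G : Ξ K m n) → CoreIs G H → Hyp K m̆ n̆ → Ξ K m n
  replaceCore G c H′ = replace G (coreEdges {G = G} c) (coreVertices {G = G} c) H′

  replaceCore-coreIs : (G : Ξ K m n) (c : CoreIs G H) →
    AllDeg2 H′ → CoreIs (replaceCore G c H′) H′
  replaceCore-coreIs {H′ = H′} G (W , tc , f , si , enum , g , si-g , enum-g , _) deg′ =
    W , isTwoCore-transfer d tc (replace-minDeg2 G f g H′ f-inj enum-g deg′) ,
    f , si ,
    enumerates-⇔ (inducedEdge-transfer d (λ _ → id)) (inducedEdge-transfer⁻ d (λ _ → id)) enum ,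
    g , si-g , enum-g , replace-hit G f g H′ f-inj
    where
    f-inj : Injective _≡_ _≡_ f
    f-inj = strictlyIncreasing⇒injective si
    d : DifferOnlyInside G (replace G f g H′) W
    d = replace-differOnlyInside G f g H′ f-inj
          (enumerates⇒∈ enum) (λ j → enumerates⇒∈ (enum-g j))

  replaceCore-inverse : (G : Ξ K m n) (c : CoreIs G H) (deg′ : AllDeg2 H′)
    (c′ : CoreIs (replaceCore G c H′) H′) → replaceCore (replaceCore G c H′) c′ H ≡ G
  replaceCore-inverse {H = H} {H′ = H′}
    G c@(_ , _ , f , _ , _ , g , _ , _ , eqs) deg′ c′@(_ , _ , f′ , si′ , _ , g′ , _) =
    Ξ-ext λ i j → restore i j (any? λ k → f k ≟ i)
    where
    open ≡-Reasoning
    G′ G″ : Ξ K m n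
    G′ = replace G f g H′
    G″ = replace G′ f′ g′ H
    f≗f′ : f ≗ f′
    f≗f′ = proj₁ (coreIs-unique {G = G′} (replaceCore-coreIs G c deg′) c′)
    g≗g′ : g ≗² g′
    g≗g′ = proj₁ (proj₂ (coreIs-unique {G = G′} (replaceCore-coreIs G c deg′) c′))
    f′-inj : Injective _≡_ _≡_ f′
    f′-inj = strictlyIncreasing⇒injective si′
    restore : ∀ i j → Dec (∃ λ k → f k ≡ i) → vertexOf G″ i j ≡ vertexOf G i j
    restore _ j (yes (k , refl)) = begin
      vertexOf G″ (f k) j   ≡⟨ cong (λ i → vertexOf G″ i j) (f≗f′ k) ⟩
      vertexOf G″ (f′ k) j  ≡⟨ replace-hit G′ f′ g′ H f′-inj k j ⟩
      g′ j (H k j)          ≡⟨ g≗g′ j (H k j) ⟨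
      g j (H k j)           ≡⟨ eqs k j ⟨
      vertexOf G (f k) j    ∎
    restore i j (no i∉f) = begin
      vertexOf G″ i j  ≡⟨ replace-miss G′ f′ g′ H i∉f′ j ⟩
      vertexOf G′ i j  ≡⟨ replace-miss G f g H′ (λ k fk≡i → i∉f (k , fk≡i)) j ⟩
      vertexOf G i j   ∎
      where
      i∉f′ : ∀ k → f′ k ≢ i
      i∉f′ k f′k≡i = i∉f (k , trans (f≗f′ k) f′k≡i)

proposition6p5 : (K n m : ℕ) → 3 ≤ K → 1 ≤ n → 1 ≤ m →
    (m̆ : ℕ) (n̆ : Fin K → ℕ) (H₁ H₂ : Hyp K m̆ n̆) → AllDeg2 H₁ → AllDeg2 H₂ →
    Σ (Ξ K m n → Ξ K m n) λ φ → Σ (Ξ K m n → Ξ K m n) λ ψ →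
      (∀ G → ψ (φ G) ≡ G) × (∀ G → φ (ψ G) ≡ G) ×
      (∀ G → (CoreIs G H₁ → CoreIs (φ G) H₂) × (CoreIs (φ G) H₂ → CoreIs G H₁))
proposition6p5 K n m _ _ _ m̆ n̆ H₁ H₂ deg₁ deg₂
  with all? (λ k → all? λ j → H₁ k j ≟ H₂ k j)
... | yes H₁≗H₂ = id , id , (λ _ → refl) , (λ _ → refl) ,
  λ G → coreIs-cong {G = G} H₁≗H₂ , coreIs-cong {G = G} (λ k j → sym (H₁≗H₂ k j))
... | no H₁≉H₂ = swap , swap , swap-involutive , swap-involutive , λ G → swap-P⇒Q , swap-Q⇒P
  where
  open Swap (λ G → coreIs? G H₁) (λ G → coreIs? G H₂)
    (λ {G} c₁ c₂ → H₁≉H₂ (proj₂ (proj₂ (coreIs-unique {G = G} c₁ c₂))))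
    (λ {G} c → replaceCore G c H₂) (λ {G} c → replaceCore G c H₁)
    (λ {G} c → replaceCore-coreIs G c deg₂) (λ {G} c → replaceCore-coreIs G c deg₁)
    (λ {G} c → replaceCore-inverse G c deg₂) (λ {G} c → replaceCore-inverse G c deg₁)
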